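{- Let $T$ be a tree with all vertex degrees at most $3$ and $\mathcal{R}$ a finite multiset of rooted subtrees of $T$. Perform a BFS of $T$ from some root and enumerate the edges $e_1,\dots,e_m$ in order of discovery. For $i\ge 1$ let $\mathcal{P}_{i-1}$ be the sub-multiset of members of $\mathcal{R}$ containing (in either direction) at least one of $e_1,\dots,e_{i-1}$, and let $\mathcal{Q}_i=\mathcal{R}[e_i]\setminus\mathcal{P}_{i-1}$. Write $e_i=\{u,v\}$ with $u$ discovered before $v$. Suppose $\vec{P}\in\mathcal{P}_{i-1}$ collides with some $\vec{Q}\in\mathcal{Q}_i$. Then: - if $e_i$ is not of type 4, then $\vec{P}\in\mathcal{P}_{i-1}[\{u,v\}]$; - if $e_i$ is of type 4, with $\{u,w\}$ and $\{u,x\}$ as in the definition of type 4, then $\vec{P}\in\mathcal{P}_{i-1}[\{u,v\}]\cup\mathcal{P}_{i-1}[\{u,x\}]$.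
   Context: Rooted tree: directed graph whose underlying undirected multigraph is a tree, with exactly one vertex of in-degree $0$ and all others of in-degree $1$; rooted subtree of $T$: a rooted tree whose underlying undirected graph is a subtree of $T$. Two rooted subtrees collide if they share a directed edge. For an edge $\{a,b\}$ of $T$, $\mathcal{S}[\{a,b\}]$ is the sub-multiset of members of $\mathcal{S}$ containing $(a,b)$ or $(b,a)$. In BFS on a tree, edge $\{a,b\}$ is discovered when the search, exploring the discovered vertex $a$, first reaches $b$. The edge $e_i=\{u,v\}$ is of type 4 if $u$ has degree $3$ with other incident edges $\{u,w\}=e_j$ and $\{u,x\}=e_k$ where $j<i<k$. -}

module Defs where

open import Data.Nat using (ℕ; zero; suc; _+_; _≤_; _<_)
open import Data.Fin using (Fin; toℕ) renaming (zero to fzero; suc to fsuc)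
open import Data.Bool using (Bool; true; false; if_then_else_; _∨_)
open import Data.List using (List; []; _∷_; _++_; map; length; lookup)
open import Data.Nat.ListAction using (sum)
open import Data.List.Relation.Unary.Unique.Propositional using (Unique)
open import Data.Product using (Σ; ∃; _×_; _,_)
open import Data.Sum using (_⊎_)
open import Data.Unit using (⊤)
open import Data.Empty using (⊥)
open import Relation.Nullary using (¬_)
open import Relation.Binary.PropositionalEquality using (_≡_)
open import Data.List using (allFin) public

Chain : ∀ {n} → (Fin n → Fin n → Bool) → List (Fin n) → Set
Chain A []           = ⊤
Chain A (x ∷ [])     = ⊤
Chain A (x ∷ y ∷ xs) = A x y ≡ true × Chain A (y ∷ xs)

lastOr : ∀ {n} → Fin n → List (Fin n) → Fin n
lastOr a []       = a
lastOr a (x ∷ xs) = lastOr x xs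

Connected : ∀ {n} → (Fin n → Bool) → (Fin n → Fin n → Bool) → Set
Connected V A = ∀ a b → V a ≡ true → V b ≡ true →
  ∃ λ xs → Chain A (a ∷ xs) × lastOr a xs ≡ b

Acyclic : ∀ {n} → (Fin n → Fin n → Bool) → Set
Acyclic A = ∀ x y z rest → Unique (x ∷ y ∷ z ∷ rest) →
  ¬ Chain A ((x ∷ y ∷ z ∷ rest) ++ (x ∷ []))

IsTree : ∀ {n} → (Fin n → Bool) → (Fin n → Fin n → Bool) → Set
IsTree V A = (∃ λ a → V a ≡ true) × Connected V A × Acyclic A

record Graph (n : ℕ) : Set where
  field
    E   : Fin n → Fin n → Bool
    sym : ∀ a b → E a b ≡ E b a
    irr : ∀ a → E a a ≡ false
open Graph public

Tree : ∀ {n} → Graph n → Set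
Tree T = IsTree (λ _ → true) (E T)

count : ∀ {n} → (Fin n → Bool) → ℕ
count {n} P = sum (map (λ b → if P b then 1 else 0) (allFin n))

deg : ∀ {n} → Graph n → Fin n → ℕ
deg T a = count (λ b → E T a b)

MaxDeg≤3 : ∀ {n} → Graph n → Set
MaxDeg≤3 {n} T = ∀ (a : Fin n) → deg T a ≤ 3

record RootedSubtree {n} (T : Graph n) : Set where
  field
    verts     : Fin n → Bool
    arc       : Fin n → Fin n → Bool
    arc-verts : ∀ a b → arc a b ≡ true → verts a ≡ true × verts b ≡ true
    arc-T     : ∀ a b → arc a b ≡ true → E T a b ≡ true
    -- the underlying multigraph has no pair of parallel edges
    no-anti   : ∀ a b → arc a b ≡ true → arc b a ≡ false
    tree      : IsTree verts (λ a b → arc a b ∨ arc b a)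
    root      : Fin n
    root-in   : verts root ≡ true
    root-deg  : count (λ a → arc a root) ≡ 0
    other-deg : ∀ b → verts b ≡ true → ¬ b ≡ root → count (λ a → arc a b) ≡ 1
open RootedSubtree public

Has : ∀ {n} {T : Graph n} → RootedSubtree T → Fin n → Fin n → Set
Has S a b = arc S a b ≡ true ⊎ arc S b a ≡ true

Collide : ∀ {n} {T : Graph n} → RootedSubtree T → RootedSubtree T → Set
Collide {n} P Q = Σ (Fin n) λ a → Σ (Fin n) λ b → arc P a b ≡ true × arc Q a b ≡ true

-- Breadth-first search of a graph T on Fin (suc m) from root r.
-- ord k is the k-th discovered vertex (ord 0 = r).  For j : Fin m, the
-- vertex ord (j+1) is discovered while exploring ord (par j); vertices are
-- explored in order of discovery (FIFO), so par is monotone; exploring a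
-- vertex discovers all its not-yet-discovered neighbours.

record BFS {m} (T : Graph (suc m)) (r : Fin (suc m)) : Set where
  field
    ord      : Fin (suc m) → Fin (suc m)
    ord-inj  : ∀ a b → ord a ≡ ord b → a ≡ b
    ord-root : ord fzero ≡ r
    par      : Fin m → Fin (suc m)
    par-earlier : ∀ j → toℕ (par j) ≤ toℕ j
    par-adj  : ∀ j → E T (ord (par j)) (ord (fsuc j)) ≡ true
    par-fifo : ∀ j k → toℕ j ≤ toℕ k → toℕ (par j) ≤ toℕ (par k)
    complete : ∀ k t → E T (ord k) (ord t) ≡ true →
      t ≡ fzero ⊎ Σ (Fin m) λ j → t ≡ fsuc j × toℕ (par j) ≤ toℕ k

module _ {m} {T : Graph (suc m)} {r : Fin (suc m)} (B : BFS T r) where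
  open BFS B

  -- the (j+1)-th discovered edge e_{j+1} = {eu j , ev j}; eu j discovered
  -- before ev j
  eu : Fin m → Fin (suc m)
  eu j = ord (par j)

  ev : Fin m → Fin (suc m)
  ev j = ord (fsuc j)

  EdgeIs : Fin m → Fin (suc m) → Fin (suc m) → Set
  EdgeIs j a b = (eu j ≡ a × ev j ≡ b) ⊎ (eu j ≡ b × ev j ≡ a)

  -- type 4 (edge e_{i+1} = {u,v}, u = eu i): u has degree 3 and its other
  -- incident edges are {u,w} = e_{j+1}, {u,x} = e_{k+1} with j < i < k
  record Type4 (i : Fin m) : Set where
    field
      w x : Fin (suc m)
      j k : Fin m
      j<i : toℕ j < toℕ i
      i<k : toℕ i < toℕ k
      deg3 : deg T (eu i) ≡ 3
      ej : EdgeIs j (eu i) w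
      ek : EdgeIs k (eu i) x

  -- S ∈ 𝒫_{i} (0-based: S contains one of the edges before e_{i+1})
  InP : RootedSubtree T → Fin m → Set
  InP S i = Σ (Fin m) λ j → toℕ j < toℕ i × Has S (eu j) (ev j)

  -- S ∈ 𝒬_{i+1} = ℛ[e_{i+1}] ∖ 𝒫_i
  InQ : RootedSubtree T → Fin m → Set
  InQ S i = Has S (eu i) (ev i) × ¬ InP S i

module Submission where

-- Idea of the proof.  Index vertices by their BFS discovery position, so
-- that e_{j+1} joins the positions par j and j+1, and let u be the vertex
-- at position par i, the upper end of e_{i+1}.
--
-- (1) Because T is acyclic, every edge of T is a discovery edge: an extra
--     edge would close a cycle with the two parent paths to the root.
--     Hence the BFS edges form a rooted tree, and the BFS subtree below a
--     position k+1 can be entered from outside only through e_{k+1}.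
-- (2) Q contains e_{i+1} but no earlier edge, so a walk inside Q starting
--     at u never leaves "u together with the BFS subtrees of the children
--     of u discovered by e_{k+1}, k ≥ i".  Since P collides with Q, P has
--     a vertex there; P also contains an earlier edge, whose lower end lies
--     outside these subtrees.  Walking inside P between the two shows that
--     P contains an edge e_{k+1} at u with k ≥ i.
-- (3) If k = i we are done.  If k > i, then u has an earlier neighbour
--     (towards the root, or via e_1 if u is the root) and the children
--     reached by e_{i+1} and e_{k+1}; as deg u ≤ 3, e_{i+1} is of type 4
--     and the edge e_{k+1} is necessarily the edge {u,x}.

open import Defs renaming (sym to E-sym)
open import Data.Nat using (ℕ; zero; suc; _+_; _≤_; _<_; z≤n; s≤s; _<?_)
open import Data.Nat.Properties
open import Data.Fin using (Fin; toℕ; punchOut) renaming (zero to fzero; suc to fsuc)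
import Data.Fin.Properties as FP
open import Data.Bool using (Bool; true; false; _∨_; if_then_else_)
open import Data.List using (List; []; _∷_; _++_; map; length; lookup)
open import Data.List.Properties using (length-map)
open import Data.Nat.ListAction using (sum)
open import Data.List.Relation.Unary.All using (All; []; _∷_)
import Data.List.Relation.Unary.All as All
import Data.List.Relation.Unary.All.Properties as AllP
open import Data.List.Relation.Unary.Any using (here; there)
open import Data.List.Relation.Unary.AllPairs using ([]; _∷_)
open import Data.List.Relation.Unary.Unique.Propositional using (Unique)
import Data.List.Relation.Unary.Unique.Propositional.Properties as UniqueP
open import Data.List.Membership.Propositional using (_∈_)
open import Data.List.Membership.Propositional.Properties using (∈-∃++; ∈-allFin)
import Data.List.Membership.DecPropositional as DecMembership
open import Data.Product using (Σ; _×_; _,_; proj₁; proj₂)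
open import Data.Sum using (_⊎_; inj₁; inj₂)
open import Data.Unit using (tt)
open import Data.Empty using (⊥-elim)
open import Relation.Nullary using (¬_; Dec; yes; no; does)
open import Relation.Nullary.Decidable using (dec-true)
open import Relation.Binary using (tri<; tri≈; tri>)
open import Relation.Binary.PropositionalEquality

∨-true : ∀ a b → a ∨ b ≡ true → a ≡ true ⊎ b ≡ true
∨-true true  _ _ = inj₁ refl
∨-true false _ p = inj₂ p

unique-upto : ∀ {A : Set} (as : List A) b bs → Unique (as ++ b ∷ bs) → Unique (as ++ b ∷ [])
unique-upto []       b bs (_ ∷ _) = [] ∷ []
unique-upto (a ∷ as) b bs (a∉ ∷ u) = upto a∉ ∷ unique-upto as b bs u
  where
  upto : ∀ {P : _ → Set} → All P (as ++ b ∷ bs) → All P (as ++ b ∷ [])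
  upto ps with AllP.++⁻ as ps
  ... | pas , (pb ∷ _) = AllP.++⁺ pas (pb ∷ [])

module Walks {n : ℕ} (A : Fin n → Fin n → Bool) where

  walk-invariant : (G : Fin n → Set) → (∀ c d → G c → A c d ≡ true → G d) →
    ∀ a xs → Chain A (a ∷ xs) → G a → G (lastOr a xs)
  walk-invariant G step a []       _          g = g
  walk-invariant G step a (x ∷ xs) (e , walk) g = walk-invariant G step x xs walk (step a x g e)

  walk-crossing : (D : Fin n → Set) → (∀ c → Dec (D c)) → ∀ a xs → Chain A (a ∷ xs) →
    ¬ D a → D (lastOr a xs) →
    Σ (Fin n) λ c₁ → Σ (Fin n) λ c₂ → A c₁ c₂ ≡ true × ¬ D c₁ × D c₂
  walk-crossing D D? a []       _          out inside = ⊥-elim (out inside)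
  walk-crossing D D? a (x ∷ xs) (e , walk) out inside with D? x
  ... | yes x∈D = a , x , e , out , x∈D
  ... | no  x∉D = walk-crossing D D? x xs walk x∉D inside

  walk-upto : ∀ as b bs → Chain A (as ++ b ∷ bs) → Chain A (as ++ b ∷ [])
  walk-upto []            b bs _          = tt
  walk-upto (a ∷ [])      b bs (e , _)    = e , tt
  walk-upto (a ∷ a′ ∷ as) b bs (e , walk) = e , walk-upto (a′ ∷ as) b bs walk

  walk-snoc : ∀ as b c → Chain A (as ++ b ∷ []) → A b c ≡ true → Chain A ((as ++ b ∷ []) ++ c ∷ [])
  walk-snoc []            b c _          e = e , tt
  walk-snoc (a ∷ [])      b c (e₁ , _)   e = e₁ , e , tt
  walk-snoc (a ∷ a′ ∷ as) b c (e₁ , walk) e = e₁ , walk-snoc (a′ ∷ as) b c walk e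

lastOr-∈ : ∀ {n} (a : Fin n) xs → lastOr a xs ∈ a ∷ xs
lastOr-∈ a []       = here refl
lastOr-∈ a (x ∷ xs) = there (lastOr-∈ x xs)

module Acyclicity {n : ℕ} (A : Fin n → Fin n → Bool) (A-sym : ∀ a b → A a b ≡ A b a)
  (acyclic : Acyclic A) where
  open Walks A

  no-cycle : ∀ x y L z → Unique (x ∷ y ∷ (L ++ z ∷ [])) →
    ¬ Chain A ((x ∷ y ∷ (L ++ z ∷ [])) ++ x ∷ [])
  no-cycle x y []      z = acyclic x y z []
  no-cycle x y (p ∷ L) z = acyclic x y p (L ++ z ∷ [])

  -- If z₁ lies on the first path, that path closes
  -- a cycle with the edge z₁x; otherwise extend the first path backwards by
  -- z₁ and recurse along the second one.
  paths-diverge : ∀ x y₁ xs z₁ ys → ¬ y₁ ≡ z₁ →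
    Unique (x ∷ y₁ ∷ xs) → Unique (x ∷ z₁ ∷ ys) →
    Chain A (x ∷ y₁ ∷ xs) → Chain A (x ∷ z₁ ∷ ys) → ¬ lastOr y₁ xs ≡ lastOr z₁ ys
  paths-diverge x y₁ xs z₁ ys y₁≢z₁ u₁ u₂ walk₁ (e , walk₂) same
    with DecMembership._∈?_ FP._≟_ z₁ xs
  ... | yes z₁∈xs with ∈-∃++ z₁∈xs
  ...   | pre , post , refl =
    no-cycle x y₁ pre z₁ (unique-upto (x ∷ y₁ ∷ pre) z₁ post u₁)
      (walk-snoc (x ∷ y₁ ∷ pre) z₁ x (walk-upto (x ∷ y₁ ∷ pre) z₁ post walk₁)
        (trans (A-sym z₁ x) e))
  paths-diverge x y₁ xs z₁ [] y₁≢z₁ u₁ u₂ walk₁ (e , walk₂) same | no z₁∉xs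
    with lastOr-∈ y₁ xs
  ... | here  y₁-last  = y₁≢z₁ (trans (sym y₁-last) same)
  ... | there in-xs    = z₁∉xs (subst (_∈ xs) same in-xs)
  paths-diverge x y₁ xs z₁ (z₂ ∷ ys) y₁≢z₁ u₁ ((x≢z₁ ∷ x≢z₂ ∷ _) ∷ u₂) walk₁ (e , walk₂) same
    | no z₁∉xs =
    paths-diverge z₁ x (y₁ ∷ xs) z₂ ys x≢z₂
      (((λ z₁≡x → x≢z₁ (sym z₁≡x)) ∷ (λ z₁≡y₁ → y₁≢z₁ (sym z₁≡y₁)) ∷ AllP.¬Any⇒All¬ xs z₁∉xs) ∷ u₁)
      u₂ (trans (A-sym z₁ x) e , walk₁) walk₂ same

module Counting {n : ℕ} where

  indicator : Bool → ℕ
  indicator b = if b then 1 else 0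

  countIn : (Fin n → Bool) → List (Fin n) → ℕ
  countIn P ys = sum (map (λ b → indicator (P b)) ys)

  _without_ : (Fin n → Bool) → Fin n → Fin n → Bool
  (P without x) b = if does (b FP.≟ x) then false else P b

  without-⊆ : ∀ P x b → (P without x) b ≡ true → P b ≡ true
  without-⊆ P x b h with does (b FP.≟ x)
  ... | false = h

  without-keeps : ∀ P x b → ¬ x ≡ b → P b ≡ true → (P without x) b ≡ true
  without-keeps P x b x≢b h with b FP.≟ x
  ... | yes b≡x = ⊥-elim (x≢b (sym b≡x))
  ... | no  _   = h

  indicator-mono : ∀ a b → (a ≡ true → b ≡ true) → indicator a ≤ indicator b
  indicator-mono false _ _ = z≤n
  indicator-mono true  b f rewrite f refl = ≤-refl

  countIn-mono : ∀ {P Q} ys → (∀ b → P b ≡ true → Q b ≡ true) → countIn P ys ≤ countIn Q ys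
  countIn-mono []       _ = z≤n
  countIn-mono {P} {Q} (y ∷ ys) h = +-mono-≤ (indicator-mono (P y) (Q y) (h y)) (countIn-mono ys h)

  countIn-without : ∀ P x ys → x ∈ ys → P x ≡ true → suc (countIn (P without x) ys) ≤ countIn P ys
  countIn-without P x (.x ∷ ys) (here refl) Px
    rewrite dec-true (x FP.≟ x) refl | Px = s≤s (countIn-mono ys (without-⊆ P x))
  countIn-without P x (y ∷ ys) (there x∈ys) Px =
    subst (_≤ indicator (P y) + countIn P ys)
      (+-suc (indicator ((P without x) y)) (countIn (P without x) ys))
      (+-mono-≤ (indicator-mono _ _ (without-⊆ P x y)) (countIn-without P x ys x∈ys Px))

  distinct-≤-count : ∀ P xs → Unique xs → All (λ x → P x ≡ true) xs → length xs ≤ count P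
  distinct-≤-count P []       _          _          = z≤n
  distinct-≤-count P (x ∷ xs) (x∉ ∷ u)   (Px ∷ Pxs) =
    ≤-trans (s≤s (distinct-≤-count (P without x) xs u
              (All.zipWith (λ (x≢b , Pb) → without-keeps P x _ x≢b Pb) (x∉ , Pxs))))
            (countIn-without P x (allFin n) (∈-allFin x) Px)

open Counting using (distinct-≤-count)

injective⇒onto : ∀ {n} (f : Fin (suc n) → Fin (suc n)) → (∀ {a b} → f a ≡ f b → a ≡ b) →
  ∀ v → Σ (Fin (suc n)) λ a → f a ≡ v
injective⇒onto {n} f f-inj v with FP.any? (λ a → f a FP.≟ v)
... | yes hit = hit
... | no  miss = ⊥-elim (1+n≰n (FP.injective⇒≤ {f = avoid} avoid-inj))
  where
  avoid : Fin (suc n) → Fin n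
  avoid a = punchOut {i = v} {j = f a} (λ v≡fa → miss (a , sym v≡fa))
  avoid-inj : ∀ {a b} → avoid a ≡ avoid b → a ≡ b
  avoid-inj {a} {b} e =
    f-inj (FP.punchOut-injective {i = v} (λ v≡fa → miss (a , sym v≡fa)) (λ v≡fb → miss (b , sym v≡fb)) e)

module SubtreeEdges {n : ℕ} {T : Graph n} (S : RootedSubtree T) where

  Adj : Fin n → Fin n → Bool
  Adj a b = arc S a b ∨ arc S b a

  connected : Connected (verts S) Adj
  connected = proj₁ (proj₂ (tree S))

  adj⇒has : ∀ {a b} → Adj a b ≡ true → Has S a b
  adj⇒has {a} {b} = ∨-true (arc S a b) (arc S b a)

  has-swap : ∀ {a b} → Has S a b → Has S b a
  has-swap (inj₁ ab) = inj₂ ab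
  has-swap (inj₂ ba) = inj₁ ba

  has-edge : ∀ {a b} → Has S a b → E T a b ≡ true
  has-edge {a} {b} (inj₁ ab) = arc-T S a b ab
  has-edge {a} {b} (inj₂ ba) = trans (E-sym T a b) (arc-T S b a ba)

  has-verts : ∀ {a b} → Has S a b → verts S a ≡ true × verts S b ≡ true
  has-verts {a} {b} (inj₁ ab) = arc-verts S a b ab
  has-verts {a} {b} (inj₂ ba) = let (vb , va) = arc-verts S b a ba in va , vb

open SubtreeEdges

module Discovery {m : ℕ} {T : Graph (suc m)} (acyclic : Acyclic (E T))
  {r : Fin (suc m)} (B : BFS T r) where
  open BFS B
  open Acyclicity (E T) (E-sym T) acyclic

  Pos : Set
  Pos = Fin (suc m)

  ord-injective : ∀ {a b} → ord a ≡ ord b → a ≡ b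
  ord-injective {a} {b} = ord-inj a b

  idx : Fin (suc m) → Pos
  idx v = proj₁ (injective⇒onto ord ord-injective v)

  ord-idx : ∀ v → ord (idx v) ≡ v
  ord-idx v = proj₂ (injective⇒onto ord ord-injective v)

  idx-ord : ∀ a → idx (ord a) ≡ a
  idx-ord a = ord-injective (ord-idx (ord a))

  par<suc : ∀ j → toℕ (par j) < toℕ (fsuc j)
  par<suc j = s≤s (par-earlier j)

  child-of-earlier : ∀ i j → fsuc j ≡ par i → toℕ j < toℕ i
  child-of-earlier i j e = subst (λ a → toℕ a ≤ toℕ i) (sym e) (par-earlier i)

  positions-distinct : ∀ {a b : Pos} → toℕ b < toℕ a → ¬ a ≡ b
  positions-distinct b<a a≡b = <⇒≢ b<a (cong toℕ (sym a≡b))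

  earlier-distinct : ∀ {a b : Pos} → toℕ a < toℕ b → ¬ a ≡ b
  earlier-distinct a<b a≡b = <⇒≢ a<b (cong toℕ a≡b)

  climb : ℕ → Pos → List Pos
  climb _       fzero    = []
  climb zero    (fsuc j) = []
  climb (suc n) (fsuc j) = par j ∷ climb n (par j)

  ancestors : Pos → List Pos
  ancestors a = climb (toℕ a) a

  climb-earlier : ∀ n a → toℕ a ≤ n → All (λ b → toℕ b < toℕ a) (climb n a)
  climb-earlier n       fzero    _         = []
  climb-earlier zero    (fsuc j) ()
  climb-earlier (suc n) (fsuc j) (s≤s a≤n) =
    par<suc j ∷ All.map (λ b<pj → <-trans b<pj (par<suc j))
                  (climb-earlier n (par j) (≤-trans (par-earlier j) a≤n))

  climb-unique : ∀ n a → toℕ a ≤ n → Unique (a ∷ climb n a)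
  climb-unique n       fzero    _         = [] ∷ []
  climb-unique zero    (fsuc j) ()
  climb-unique (suc n) (fsuc j) (s≤s a≤n) =
    All.map positions-distinct (climb-earlier (suc n) (fsuc j) (s≤s a≤n))
    ∷ climb-unique n (par j) (≤-trans (par-earlier j) a≤n)

  climb-walk : ∀ n a → Chain (E T) (ord a ∷ map ord (climb n a))
  climb-walk _       fzero    = tt
  climb-walk zero    (fsuc j) = tt
  climb-walk (suc n) (fsuc j) = trans (E-sym T _ _) (par-adj j) , climb-walk n (par j)

  climb-end : ∀ n a → toℕ a ≤ n → lastOr (ord a) (map ord (climb n a)) ≡ ord fzero
  climb-end n       fzero    _         = refl
  climb-end zero    (fsuc j) ()
  climb-end (suc n) (fsuc j) (s≤s a≤n) = climb-end n (par j) (≤-trans (par-earlier j) a≤n)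

  above-ancestors-unique : ∀ {a b} → toℕ b < toℕ a → Unique (a ∷ b ∷ ancestors b)
  above-ancestors-unique {a} {b} b<a =
    All.map positions-distinct
      (b<a ∷ All.map (λ c<b → <-trans c<b b<a) (climb-earlier (toℕ b) b ≤-refl))
    ∷ climb-unique (toℕ b) b ≤-refl

  -- An edge of T from an earlier position s to t is the discovery edge of t:
  -- otherwise ord t would be joined to the root by the ancestor paths of s
  -- and of par j, leaving it through different neighbours.
  forward-edge : ∀ s t → toℕ s < toℕ t → E T (ord s) (ord t) ≡ true →
    Σ (Fin m) λ j → par j ≡ s × fsuc j ≡ t
  forward-edge s t s<t e with complete s t e
  ... | inj₁ refl = ⊥-elim (n≮0 s<t)
  ... | inj₂ (j , refl , _) with par j FP.≟ s
  ...   | yes pj≡s = j , pj≡s , refl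
  ...   | no  pj≢s = ⊥-elim (paths-diverge
            (ord (fsuc j)) (ord s) (map ord (ancestors s)) (ord (par j)) (map ord (ancestors (par j)))
            (λ e′ → pj≢s (sym (ord-injective e′)))
            (UniqueP.map⁺ ord-injective (above-ancestors-unique s<t))
            (UniqueP.map⁺ ord-injective (above-ancestors-unique (par<suc j)))
            (trans (E-sym T _ _) e , climb-walk (toℕ s) s)
            (trans (E-sym T _ _) (par-adj j) , climb-walk (toℕ (par j)) (par j))
            (trans (climb-end (toℕ s) s ≤-refl) (sym (climb-end (toℕ (par j)) (par j) ≤-refl))))

  DiscoveryEdge : Fin m → Pos → Pos → Set
  DiscoveryEdge j s t = (par j ≡ s × fsuc j ≡ t) ⊎ (par j ≡ t × fsuc j ≡ s)

  discovery-edge : ∀ s t → E T (ord s) (ord t) ≡ true → Σ (Fin m) λ j → DiscoveryEdge j s t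
  discovery-edge s t e with <-cmp (toℕ s) (toℕ t)
  ... | tri< s<t _ _ = let (j , p , q) = forward-edge s t s<t e in j , inj₁ (p , q)
  ... | tri> _ _ t<s = let (j , p , q) = forward-edge t s t<s (trans (E-sym T _ _) e) in j , inj₂ (p , q)
  ... | tri≈ _ s≡t _ with FP.toℕ-injective s≡t
  ...   | refl = ⊥-elim (true≢false (trans (sym e) (irr T (ord s))))
    where
    true≢false : ¬ true ≡ false
    true≢false ()

  data Desc (y : Pos) : Pos → Set where
    here : Desc y y
    step : ∀ j → Desc y (par j) → Desc y (fsuc j)

  desc-later : ∀ {y x} → Desc y x → toℕ y ≤ toℕ x
  desc-later here       = ≤-refl
  desc-later (step j d) = ≤-trans (desc-later d) (<⇒≤ (par<suc j))

  desc?-fuel : ∀ n y x → toℕ x ≤ n → Dec (Desc y x)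
  desc?-fuel n y fzero _ with y FP.≟ fzero
  ... | yes refl = yes here
  ... | no  y≢0  = no λ { here → y≢0 refl }
  desc?-fuel zero y (fsuc j) ()
  desc?-fuel (suc n) y (fsuc j) (s≤s x≤n)
    with y FP.≟ fsuc j | desc?-fuel n y (par j) (≤-trans (par-earlier j) x≤n)
  ... | yes refl | _     = yes here
  ... | no  _    | yes d = yes (step j d)
  ... | no  y≢x  | no nd = no λ { here → y≢x refl ; (step .j d) → nd d }

  desc? : ∀ y x → Dec (Desc y x)
  desc? y x = desc?-fuel (toℕ x) y x ≤-refl

  entering-edge : ∀ k s t → E T (ord s) (ord t) ≡ true →
    ¬ Desc (fsuc k) s → Desc (fsuc k) t → par k ≡ s × fsuc k ≡ t
  entering-edge k s t e out inside = through (proj₂ (discovery-edge s t e)) out inside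
    where
    through : ∀ {j s t} → DiscoveryEdge j s t → ¬ Desc (fsuc k) s → Desc (fsuc k) t → par k ≡ s × fsuc k ≡ t
    through (inj₁ (refl , refl)) out here         = refl , refl
    through (inj₁ (refl , refl)) out (step _ d)   = ⊥-elim (out d)
    through {j} (inj₂ (refl , refl)) out d        = ⊥-elim (out (step j d))

  first-edge : Fin m → Σ (Fin m) λ z → toℕ z ≡ 0
  first-edge fzero    = fzero , refl
  first-edge (fsuc _) = fzero , refl

  first-edge-at-root : ∀ z → toℕ z ≡ 0 → par z ≡ fzero
  first-edge-at-root z z≡0 = FP.toℕ-injective (n≤0⇒n≡0 (subst (toℕ (par z) ≤_) z≡0 (par-earlier z)))

  -- unless e_{i+1} is the first edge, some earlier edge meets u: the edge
  -- that discovered u, or e_1 if u is the root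
  earlier-edge-at : ∀ i j₀ → toℕ j₀ < toℕ i →
    Σ (Fin m) λ j → Σ Pos λ a → toℕ j < toℕ i × EdgeIs B j (eu B i) (ord a)
  earlier-edge-at i j₀ j₀<i with par i in par-i
  ... | fzero with first-edge j₀
  ...   | z , z≡0 = z , fsuc z , subst (_< toℕ i) (sym z≡0) (≤-<-trans z≤n j₀<i) ,
                    inj₁ (cong ord (first-edge-at-root z z≡0) , refl)
  earlier-edge-at i j₀ j₀<i | fsuc j = j , par j , child-of-earlier i j (sym par-i) ,
                                        inj₂ (refl , refl)

  earlier-neighbour : ∀ i j w → toℕ j < toℕ i → EdgeIs B j (eu B i) w →
    Σ Pos λ a → ord a ≡ w × toℕ a ≤ toℕ i × E T (eu B i) (ord a) ≡ true
  earlier-neighbour i j w j<i (inj₁ (eu≡u , ev≡w)) =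
    fsuc j , ev≡w , j<i , subst (λ v → E T v (ev B j) ≡ true) eu≡u (par-adj j)
  earlier-neighbour i j w j<i (inj₂ (eu≡w , ev≡u)) =
    par j , eu≡w , ≤-trans (par-earlier j) (<⇒≤ j<i) ,
    subst (λ v → E T v (eu B j) ≡ true) ev≡u (trans (E-sym T _ _) (par-adj j))

  later-edge-at : ∀ i k x → toℕ i < toℕ k → EdgeIs B k (eu B i) x → par k ≡ par i × ev B k ≡ x
  later-edge-at i k x i<k (inj₁ (eu≡u , ev≡x)) = ord-injective eu≡u , ev≡x
  later-edge-at i k x i<k (inj₂ (_ , ev≡u)) =
    ⊥-elim (<⇒≱ i<k (<⇒≤ (child-of-earlier i k (ord-injective ev≡u))))

  children-count : ∀ i a → toℕ a ≤ toℕ i → E T (eu B i) (ord a) ≡ true →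
    ∀ ks → Unique ks → All (λ k → toℕ i < toℕ k × par k ≡ par i) ks →
    2 + length ks ≤ deg T (eu B i)
  children-count i a a≤i a-adj ks ks-unique ks-later =
    subst (_≤ deg T (eu B i)) (trans (length-map ord positions) (cong (2 +_) (length-map fsuc ks)))
      (distinct-≤-count (E T (eu B i)) (map ord positions)
        (UniqueP.map⁺ ord-injective positions-unique) (AllP.map⁺ adjacent))
    where
    positions : List Pos
    positions = a ∷ fsuc i ∷ map fsuc ks
    positions-unique : Unique positions
    positions-unique =
      (earlier-distinct (s≤s a≤i)
         ∷ AllP.map⁺ (All.map (λ (i<k , _) → earlier-distinct (s≤s (≤-trans a≤i (<⇒≤ i<k)))) ks-later))
      ∷ AllP.map⁺ (All.map (λ (i<k , _) → earlier-distinct (s≤s i<k)) ks-later)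
      ∷ UniqueP.map⁺ FP.suc-injective ks-unique
    adjacent : All (λ b → E T (eu B i) (ord b) ≡ true) positions
    adjacent = a-adj ∷ par-adj i
      ∷ AllP.map⁺ (All.map (λ {k} (_ , pk) → subst (λ p → E T (ord p) (ev B k) ≡ true) pk (par-adj k)) ks-later)

  -- a child of u discovered after e_{i+1} makes e_{i+1} of type 4, as u
  -- then has three neighbours and degree at most 3
  late-child⇒type4 : MaxDeg≤3 T → ∀ i j₀ → toℕ j₀ < toℕ i →
    ∀ k → toℕ i < toℕ k → par k ≡ par i → Type4 B i
  late-child⇒type4 max3 i j₀ j₀<i k i<k pk with earlier-edge-at i j₀ j₀<i
  ... | j , w , j<i , ej with earlier-neighbour i j (ord w) j<i ej
  ...   | a , _ , a≤i , a-adj = record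
    { w = ord w ; x = ev B k ; j = j ; k = k ; j<i = j<i ; i<k = i<k
    ; deg3 = ≤-antisym (max3 (eu B i))
               (children-count i a a≤i a-adj (k ∷ []) ([] ∷ []) ((i<k , pk) ∷ []))
    ; ej = ej ; ek = inj₁ (cong ord pk , refl) }

  -- in a type-4 configuration, every child of u discovered after e_{i+1} is x:
  -- another one would be a fourth neighbour of u
  late-child-is-x : MaxDeg≤3 T → ∀ i k → toℕ i < toℕ k → par k ≡ par i →
    (t : Type4 B i) → ev B k ≡ Type4.x t
  late-child-is-x max3 i k i<k pk t
    with later-edge-at i (Type4.k t) (Type4.x t) (Type4.i<k t) (Type4.ek t) | k FP.≟ Type4.k t
  ... | _ , evk≡x | yes refl = evk≡x
  ... | pkt , _   | no k≢kt
    with earlier-neighbour i (Type4.j t) (Type4.w t) (Type4.j<i t) (Type4.ej t)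
  ...   | a , _ , a≤i , a-adj = ⊥-elim (1+n≰n (≤-trans
          (children-count i a a≤i a-adj (Type4.k t ∷ k ∷ [])
            (((λ kt≡k → k≢kt (sym kt≡k)) ∷ []) ∷ [] ∷ [])
            ((Type4.i<k t , pkt) ∷ (i<k , pk) ∷ []))
          (max3 (eu B i))))

module Collision {m : ℕ} {T : Graph (suc m)} (acyclic : Acyclic (E T))
  {r : Fin (suc m)} (B : BFS T r) (P Q : RootedSubtree T) (i : Fin m)
  (P-early : InP B P i) (Q-fresh : InQ B Q i) where
  open BFS B
  open Discovery acyclic B
  open Walks

  j₀ : Fin m
  j₀ = proj₁ P-early

  j₀<i : toℕ j₀ < toℕ i
  j₀<i = proj₁ (proj₂ P-early)

  P∋e₀ : Has P (eu B j₀) (ev B j₀)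
  P∋e₀ = proj₂ (proj₂ P-early)

  at-positions : ∀ (S : RootedSubtree T) {c d} → Has S c d → Has S (ord (idx c)) (ord (idx d))
  at-positions S {c} {d} h rewrite ord-idx c | ord-idx d = h

  Q-avoids : ∀ j → toℕ j < toℕ i → ¬ Has Q (eu B j) (ev B j)
  Q-avoids j j<i h = proj₂ Q-fresh (j , j<i , h)

  Q-edge-at-u : ∀ s t → s ≡ par i → Has Q (ord s) (ord t) →
    Σ (Fin m) λ k → toℕ i ≤ toℕ k × par k ≡ par i × fsuc k ≡ t
  Q-edge-at-u s t s≡u h with discovery-edge s t (has-edge Q h)
  ... | j , inj₂ (refl , refl) = ⊥-elim (Q-avoids j (child-of-earlier i j s≡u) (has-swap Q h))
  ... | j , inj₁ (refl , refl) with toℕ j <? toℕ i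
  ...   | yes j<i = ⊥-elim (Q-avoids j j<i h)
  ...   | no  j≮i = j , ≮⇒≥ j≮i , s≡u , refl

  Late : Pos → Set
  Late s = s ≡ par i ⊎ Σ (Fin m) λ k → toℕ i ≤ toℕ k × par k ≡ par i × Desc (fsuc k) s

  Late-up : ∀ {k} j → toℕ i ≤ toℕ k → par k ≡ par i → Desc (fsuc k) (fsuc j) → Late (par j)
  Late-up j i≤k pk here       = inj₁ pk
  Late-up j i≤k pk (step .j d) = inj₂ (_ , i≤k , pk , d)

  Late-step : ∀ s t → Late s → Has Q (ord s) (ord t) → Late t
  Late-step s t (inj₁ s≡u) h with Q-edge-at-u s t s≡u h
  ... | k , i≤k , pk , refl = inj₂ (k , i≤k , pk , here)
  Late-step s t (inj₂ (k , i≤k , pk , d)) h with discovery-edge s t (has-edge Q h)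
  ... | j , inj₁ (refl , refl) = inj₂ (k , i≤k , pk , step j d)
  ... | j , inj₂ (refl , refl) = Late-up j i≤k pk d

  -- every vertex of Q is Late, since Q is connected and contains u
  Q-late : ∀ c → verts Q c ≡ true → Late (idx c)
  Q-late c c∈Q with connected Q (eu B i) c (proj₁ (has-verts Q (proj₁ Q-fresh))) c∈Q
  ... | xs , walk , ends =
    subst (λ v → Late (idx v)) ends
      (walk-invariant (Adj Q) (λ v → Late (idx v))
        (λ v w late adj → Late-step (idx v) (idx w) late (at-positions Q (adj⇒has Q adj)))
        (eu B i) xs walk (inj₁ (idx-ord (par i))))

  early-outside : ∀ j k → toℕ j < toℕ i → toℕ i ≤ toℕ k → ¬ Desc (fsuc k) (idx (ev B j))
  early-outside j k j<i i≤k d =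
    <⇒≱ (s≤s (<-≤-trans j<i i≤k))
      (subst (λ a → toℕ (fsuc k) ≤ toℕ a) (idx-ord (fsuc j)) (desc-later d))

  P-entering : ∀ k c₁ c₂ → Adj P c₁ c₂ ≡ true →
    ¬ Desc (fsuc k) (idx c₁) → Desc (fsuc k) (idx c₂) → Has P (eu B k) (ev B k)
  P-entering k c₁ c₂ adj out inside =
    let h = at-positions P (adj⇒has P adj)
        (par≡ , suc≡) = entering-edge k (idx c₁) (idx c₂) (has-edge P h) out inside
    in subst₂ (λ s t → Has P (ord s) (ord t)) (sym par≡) (sym suc≡) h

  -- if P reaches into the subtree of a child fsuc k (k ≥ i), it contains e_{k+1}:
  -- walk inside P from the lower end of its early edge
  P-enters : ∀ k → toℕ i ≤ toℕ k → ∀ c → verts P c ≡ true → Desc (fsuc k) (idx c) →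
    Has P (eu B k) (ev B k)
  P-enters k i≤k c c∈P inside
    with connected P (ev B j₀) c (proj₂ (has-verts P P∋e₀)) c∈P
  ... | xs , walk , ends
    with walk-crossing (Adj P) (λ v → Desc (fsuc k) (idx v)) (λ v → desc? (fsuc k) (idx v))
           (ev B j₀) xs walk (early-outside j₀ k j₀<i i≤k)
           (subst (λ v → Desc (fsuc k) (idx v)) (sym ends) inside)
  ...   | c₁ , c₂ , adj , out , inside₂ = P-entering k c₁ c₂ adj out inside₂

  P-meets-u : Collide P Q →
    Σ (Fin m) λ k → toℕ i ≤ toℕ k × par k ≡ par i × Has P (eu B k) (ev B k)
  P-meets-u (a , b , aP , aQ) with Q-late a (proj₁ (arc-verts Q a b aQ))
  ... | inj₂ (k , i≤k , pk , d) = k , i≤k , pk , P-enters k i≤k a (proj₁ (arc-verts P a b aP)) d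
  ... | inj₁ a-at-u with Q-edge-at-u (idx a) (idx b) a-at-u (at-positions Q (inj₁ aQ))
  ...   | k , i≤k , pk , suc≡ =
    k , i≤k , pk ,
    subst₂ (λ s t → Has P (ord s) (ord t)) (trans a-at-u (sym pk)) (sym suc≡) (at-positions P (inj₁ aP))

lemma4 : (m : ℕ) (T : Graph (suc m)) → Tree T → MaxDeg≤3 T →
    (r : Fin (suc m)) (B : BFS T r) (R : List (RootedSubtree T))
    (i : Fin m) (p q : Fin (length R)) →
    InP B (lookup R p) i → InQ B (lookup R q) i →
    Collide (lookup R p) (lookup R q) →
    (¬ Type4 B i → Has (lookup R p) (eu B i) (ev B i)) ×
    ((t : Type4 B i) →
    Has (lookup R p) (eu B i) (ev B i) ⊎ Has (lookup R p) (eu B i) (Type4.x t))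
lemma4 m T (_ , _ , acyclic) max3 r B R i p q P-early Q-fresh collide
  with Collision.P-meets-u acyclic B (lookup R p) (lookup R q) i P-early Q-fresh collide
... | k , i≤k , pk , P∋ek with m≤n⇒m<n∨m≡n i≤k
...   | inj₂ i≡k rewrite FP.toℕ-injective i≡k = (λ _ → P∋ek) , (λ _ → inj₁ P∋ek)
...   | inj₁ i<k =
  (λ not-type4 → ⊥-elim (not-type4 (late-child⇒type4 max3 i j₀ j₀<i k i<k pk))) ,
  (λ t → inj₂ (subst (Has (lookup R p) (eu B i)) (late-child-is-x max3 i k i<k pk t)
                 (subst (λ s → Has (lookup R p) (ord s) (ev B k)) pk P∋ek)))
  where
  open BFS B using (ord)
  open Discovery acyclic B
  open Collision acyclic B (lookup R p) (lookup R q) i P-early Q-fresh using (j₀; j₀<i)
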